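{- Let $k\ge2$ be an integer and let $D$ be a digraph of order $n$ with no isolated vertex. Then $\gamma_{trk}(D)=k$ if and only if one of the following holds: (a) $n=k$; (b) $n\ge k+1$ and there exists a set $X=\{v_1,\dots,v_t\}\subseteq V(D)$ with $2\le t\le k$ such that the induced subdigraph $D[X]$ has no isolated vertex and $V(D)\setminus X\subseteq N^+(v_i)$ for each $1\le i\le t$.
   Context: All digraphs are finite, without loops or multiple arcs (pairs of opposite arcs are allowed). $N^+(v)$, $N^-(v)$ denote out- and in-neighborhoods; a vertex is isolated if it has no in- or out-neighbors. A $k$RDF on $D$ is a function $f:V(D)\to\mathcal{P}(\{1,\dots,k\})$ such that every $v$ with $f(v)=\emptyset$ satisfies $\bigcup_{u\in N^-(v)}f(u)=\{1,\dots,k\}$; its weight is $\sum_v|f(v)|$. For $D$ with no isolated vertex, a T$k$RDF is a $k$RDF $f$ such that the subdigraph induced by $\{v:f(v)\neq\emptyset\}$ has no isolated vertex; $\gamma_{trk}(D)$ is the minimum weight of a T$k$RDF. -}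

module Defs where

open import Data.Nat using (ℕ; _≤_)
open import Data.Nat.ListAction using (sum)
open import Data.Bool using (Bool; true; false)
open import Data.Fin using (Fin)
open import Data.Fin.Subset using (Subset; _∈_; ⊥; ∣_∣)
open import Data.List using (map; allFin)
open import Data.Product using (∃; _×_)
open import Data.Sum using (_⊎_)
open import Relation.Binary.PropositionalEquality using (_≡_)
open import Relation.Nullary using (¬_)

-- A finite digraph on the vertex set Fin n (order n).
-- arc u v ≡ true means there is an arc u → v.  No loops; opposite
-- arc pairs are allowed; no multiple arcs (arc is a relation).
record Digraph (n : ℕ) : Set where
  field
    arc    : Fin n → Fin n → Bool
    noLoop : ∀ v → arc v v ≡ false

open Digraph public

Arc : ∀ {n} → Digraph n → Fin n → Fin n → Set
Arc D u v = arc D u v ≡ true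

Isolated : ∀ {n} → Digraph n → Fin n → Set
Isolated D v = ∀ u → ¬ Arc D u v × ¬ Arc D v u

NoIsolated : ∀ {n} → Digraph n → Set
NoIsolated D = ∀ v → ¬ Isolated D v

InducedNoIsolated : ∀ {n} → Digraph n → Subset n → Set
InducedNoIsolated D X =
  ∀ v → v ∈ X → ∃ λ u → u ∈ X × (Arc D u v ⊎ Arc D v u)

-- The set of colours {1,…,k} is represented by Fin k; f(v) ⊆ Fin k.
-- k-Roman dominating function.
IsRDF : ∀ {n} (k : ℕ) → Digraph n → (Fin n → Subset k) → Set
IsRDF k D f =
  ∀ v → f v ≡ ⊥ → ∀ (i : Fin k) → ∃ λ u → Arc D u v × i ∈ f u

IsTRDF : ∀ {n} (k : ℕ) → Digraph n → (Fin n → Subset k) → Set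
IsTRDF k D f =
  IsRDF k D f ×
  (∀ v → ¬ f v ≡ ⊥ → ∃ λ u → ¬ f u ≡ ⊥ × (Arc D u v ⊎ Arc D v u))

weight : ∀ {n k} → (Fin n → Subset k) → ℕ
weight {n} f = sum (map (λ v → ∣ f v ∣) (allFin n))

TRDNumber : ∀ {n} (k : ℕ) → Digraph n → ℕ → Set
TRDNumber k D m =
  (∃ λ f → IsTRDF k D f × weight f ≡ m) ×
  (∀ f → IsTRDF k D f → m ≤ weight f)

-- An empty vertex of a kRDF needs all k colours on its in-neighbours, and if no vertex
-- is empty the weight is at least n; so once n ≥ k every kRDF weighs at least k.
-- Conversely, let f be a TkRDF of weight k and X its support.  A vertex w outside X
-- already receives weight k from its in-neighbours, so a vertex of X that is not an
-- in-neighbour of w would push the weight above k: X dominates its complement.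
-- Moreover |X| ≤ k, and totality gives |X| ≥ 2.  If n ≤ k, giving one colour to every
-- vertex is a TkRDF of weight n, which forces n = k.  Given such a set X (or X = V(D)
-- when n = k), spreading the k colours over X, at least one per vertex, is a TkRDF of
-- weight k.
module Submission where

open import Defs
open import Data.Nat using (ℕ; _+_; _≤_)
open import Data.Fin using (Fin)
open import Data.Fin.Subset using (Subset; _∈_; _∉_; ∣_∣)
open import Data.Product using (∃; _×_)
open import Data.Sum using (_⊎_)
open import Function.Bundles using (_⇔_)
open import Relation.Binary.PropositionalEquality using (_≡_)

open import Data.Nat using (zero; suc; z≤n; s≤s; _<_; _≤?_)
open import Data.Nat.Properties
open import Data.Nat.ListAction using () renaming (sum to listSum)
open import Data.Fin using (zero; suc; fromℕ<)
open import Data.Fin.Subset using (Empty; _∪_; ⁅_⁆; ⋃) renaming (⊥ to ∅; ⊤ to full)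
open import Data.Fin.Subset.Properties
  using (_∈?_; nonempty?; Empty-unique; ∉⊥; ∈⊤; ∣⊥∣≡0; ∣⊤∣≡n; x∈⁅x⁆; x∈⁅y⁆⇒x≡y; ∣⁅x⁆∣≡1;
         p⊆q⇒∣p∣≤∣q∣; x∈p∪q⁺; x∈p∧x≢y⇒x∈p-y; x∈p⇒∣p-x∣<∣p∣)
open import Data.Fin.Properties using (any?)
open import Data.Bool using (true; false; not; if_then_else_)
import Data.Bool.Properties as Bool
open import Data.Vec using ([]; _∷_; here; there; tabulate)
open import Data.Vec.Properties using (≡-dec; ∷-injectiveʳ)
import Data.List as List using (tabulate)
open import Data.List.Properties using (map-tabulate)
open import Data.Product using (_,_; proj₁; proj₂)
open import Data.Sum using (inj₁; inj₂)
open import Data.Empty using (⊥-elim)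
open import Relation.Nullary using (¬_; Dec; yes; no; does; contradiction)
open import Relation.Nullary.Decidable using (_⊎-dec_)
open import Relation.Binary.PropositionalEquality using (_≢_; refl; sym; trans; cong; cong₂; subst; module ≡-Reasoning)
open import Function.Bundles using (mk⇔)
open import Function.Base using (_∘_)
open import Algebra.Properties.Monoid.Sum +-0-monoid using (sum; sum-syntax; sum-cong-≗; sum-replicate-zero)
open import Algebra.Properties.CommutativeSemigroup +-commutativeSemigroup using (xy∙z≈xz∙y)

private
  variable
    n k : ℕ

listSum-tabulate : (g : Fin n → ℕ) → listSum (List.tabulate g) ≡ sum g
listSum-tabulate {zero} g = refl
listSum-tabulate {suc n} g = cong (g zero +_) (listSum-tabulate (g ∘ suc))

weight≡∑ : (f : Fin n → Subset k) → weight f ≡ ∑[ v < n ] ∣ f v ∣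
weight≡∑ f = trans (cong listSum (map-tabulate (λ v → v) (∣_∣ ∘ f))) (listSum-tabulate (∣_∣ ∘ f))

∑-mono-≤ : {g h : Fin n → ℕ} → (∀ i → g i ≤ h i) → sum g ≤ sum h
∑-mono-≤ {zero} _ = z≤n
∑-mono-≤ {suc n} g≤h = +-mono-≤ (g≤h zero) (∑-mono-≤ (g≤h ∘ suc))

∑-mono-≤-slack : {g h : Fin n → ℕ} {c : ℕ} → (∀ i → g i ≤ h i) →
                 ∀ j → g j + c ≤ h j → sum g + c ≤ sum h
∑-mono-≤-slack {suc n} {g} {h} {c} g≤h zero gⱼ+c≤hⱼ = begin
  g zero + sum (g ∘ suc) + c  ≡⟨ xy∙z≈xz∙y (g zero) _ c ⟩
  g zero + c + sum (g ∘ suc)  ≤⟨ +-mono-≤ gⱼ+c≤hⱼ (∑-mono-≤ (g≤h ∘ suc)) ⟩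
  h zero + sum (h ∘ suc)      ∎
  where open ≤-Reasoning
∑-mono-≤-slack {suc n} {g} {h} {c} g≤h (suc j) gⱼ+c≤hⱼ = begin
  g zero + sum (g ∘ suc) + c    ≡⟨ +-assoc (g zero) _ c ⟩
  g zero + (sum (g ∘ suc) + c)  ≤⟨ +-mono-≤ (g≤h zero) (∑-mono-≤-slack (g≤h ∘ suc) j gⱼ+c≤hⱼ) ⟩
  h zero + sum (h ∘ suc)        ∎
  where open ≤-Reasoning

n≤∑ : {g : Fin n → ℕ} → (∀ i → 1 ≤ g i) → n ≤ sum g
n≤∑ {zero} _ = z≤n
n≤∑ {suc n} 1≤g = +-mono-≤ (1≤g zero) (n≤∑ (1≤g ∘ suc))

∑1≡n : ∀ n → ∑[ i < n ] 1 ≡ n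
∑1≡n zero = refl
∑1≡n (suc n) = cong suc (∑1≡n n)

∑-positive : (g : Fin n → ℕ) → 0 < sum g → ∃ λ i → 0 < g i
∑-positive {suc n} g 0<∑ with g zero in g₀≡
... | suc _ = zero , subst (0 <_) (sym g₀≡) (s≤s z≤n)
... | zero = let i , 0<gᵢ = ∑-positive (g ∘ suc) 0<∑ in suc i , 0<gᵢ

∣p∪q∣≤∣p∣+∣q∣ : (p q : Subset k) → ∣ p ∪ q ∣ ≤ ∣ p ∣ + ∣ q ∣
∣p∪q∣≤∣p∣+∣q∣ [] [] = z≤n
∣p∪q∣≤∣p∣+∣q∣ (true ∷ p) (true ∷ q) = s≤s (≤-trans (∣p∪q∣≤∣p∣+∣q∣ p q) (+-monoʳ-≤ ∣ p ∣ (n≤1+n _)))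
∣p∪q∣≤∣p∣+∣q∣ (true ∷ p) (false ∷ q) = s≤s (∣p∪q∣≤∣p∣+∣q∣ p q)
∣p∪q∣≤∣p∣+∣q∣ (false ∷ p) (true ∷ q) = ≤-trans (s≤s (∣p∪q∣≤∣p∣+∣q∣ p q)) (≤-reflexive (sym (+-suc ∣ p ∣ ∣ q ∣)))
∣p∪q∣≤∣p∣+∣q∣ (false ∷ p) (false ∷ q) = ∣p∪q∣≤∣p∣+∣q∣ p q

x∈p⇒1≤∣p∣ : {x : Fin k} {p : Subset k} → x ∈ p → 1 ≤ ∣ p ∣
x∈p⇒1≤∣p∣ {x = x} {p} x∈p =
  subst (_≤ ∣ p ∣) (∣⁅x⁆∣≡1 x) (p⊆q⇒∣p∣≤∣q∣ λ y∈⁅x⁆ → subst (_∈ p) (sym (x∈⁅y⁆⇒x≡y x y∈⁅x⁆)) x∈p)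

x∈p⇒p≢∅ : {x : Fin k} {p : Subset k} → x ∈ p → p ≢ ∅
x∈p⇒p≢∅ x∈p refl = ∉⊥ x∈p

p≢∅⇒1≤∣p∣ : {p : Subset k} → p ≢ ∅ → 1 ≤ ∣ p ∣
p≢∅⇒1≤∣p∣ {p = p} p≢∅ with nonempty? p
... | yes (_ , x∈p) = x∈p⇒1≤∣p∣ x∈p
... | no p-empty = contradiction (Empty-unique p-empty) p≢∅

1≤∣p∣⇒p≢∅ : {p : Subset k} → 1 ≤ ∣ p ∣ → p ≢ ∅
1≤∣p∣⇒p≢∅ {k} 1≤∣p∣ refl = >⇒≢ 1≤∣p∣ (∣⊥∣≡0 k)

x≢y⇒2≤∣p∣ : {x y : Fin k} {p : Subset k} → x ∈ p → y ∈ p → x ≢ y → 2 ≤ ∣ p ∣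
x≢y⇒2≤∣p∣ x∈p y∈p x≢y =
  ≤-trans (s≤s (x∈p⇒1≤∣p∣ (x∈p∧x≢y⇒x∈p-y y∈p (x≢y ∘ sym)))) (x∈p⇒∣p-x∣<∣p∣ x∈p)

_≟∅ : (p : Subset k) → Dec (p ≡ ∅)
p ≟∅ = ≡-dec Bool._≟_ p ∅

Covers : (Fin n → Subset k) → Set
Covers g = ∀ i → ∃ λ u → i ∈ g u

∈⋃ : (g : Fin n → Subset k) (u : Fin n) {i : Fin k} → i ∈ g u → i ∈ ⋃ (List.tabulate g)
∈⋃ g zero i∈gu = x∈p∪q⁺ (inj₁ i∈gu)
∈⋃ g (suc u) i∈gu = x∈p∪q⁺ (inj₂ (∈⋃ (g ∘ suc) u i∈gu))

∣⋃∣≤∑ : (g : Fin n → Subset k) → ∣ ⋃ (List.tabulate g) ∣ ≤ ∑[ u < n ] ∣ g u ∣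
∣⋃∣≤∑ {zero} {k} g = ≤-reflexive (∣⊥∣≡0 k)
∣⋃∣≤∑ {suc n} g = ≤-trans (∣p∪q∣≤∣p∣+∣q∣ (g zero) _) (+-monoʳ-≤ ∣ g zero ∣ (∣⋃∣≤∑ (g ∘ suc)))

covers⇒k≤∑ : (g : Fin n → Subset k) → Covers g → k ≤ ∑[ u < n ] ∣ g u ∣
covers⇒k≤∑ {k = k} g cover = begin
  k                          ≡⟨ ∣⊤∣≡n k ⟨
  ∣ full {k} ∣               ≤⟨ p⊆q⇒∣p∣≤∣q∣ {p = full} (λ {i} _ → ∈⋃ g (proj₁ (cover i)) (proj₂ (cover i))) ⟩
  ∣ ⋃ (List.tabulate g) ∣   ≤⟨ ∣⋃∣≤∑ g ⟩
  ∑[ u < _ ] ∣ g u ∣         ∎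
  where open ≤-Reasoning

arc? : (D : Digraph n) (u v : Fin n) → Dec (Arc D u v)
arc? D u v = arc D u v Bool.≟ true

¬Arc-loop : (D : Digraph n) (v : Fin n) → ¬ Arc D v v
¬Arc-loop D v vv with () ← trans (sym vv) (noLoop D v)

adjacent⇒≢ : (D : Digraph n) {u v : Fin n} → Arc D u v ⊎ Arc D v u → u ≢ v
adjacent⇒≢ D (inj₁ uv) refl = ¬Arc-loop D _ uv
adjacent⇒≢ D (inj₂ vu) refl = ¬Arc-loop D _ vu

neighbour : (D : Digraph n) → NoIsolated D → ∀ v → ∃ λ u → Arc D u v ⊎ Arc D v u
neighbour D noIsolated v with any? (λ u → arc? D u v ⊎-dec arc? D v u)
... | yes adjacent = adjacent
... | no ¬adjacent = ⊥-elim (noIsolated v λ u → ¬adjacent ∘ (u ,_) ∘ inj₁ , ¬adjacent ∘ (u ,_) ∘ inj₂)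

DominatesComplement : Digraph n → Subset n → Set
DominatesComplement D X = ∀ v → v ∈ X → ∀ w → w ∉ X → Arc D v w

restrictIn : Digraph n → Fin n → (Fin n → Subset k) → Fin n → Subset k
restrictIn D w f u = if arc D u w then f u else ∅

∣restrictIn∣≤ : (D : Digraph n) (w : Fin n) (f : Fin n → Subset k) (u : Fin n) →
                ∣ restrictIn D w f u ∣ ≤ ∣ f u ∣
∣restrictIn∣≤ {k = k} D w f u with arc D u w
... | true = ≤-refl
... | false = ≤-trans (≤-reflexive (∣⊥∣≡0 k)) z≤n

restrictIn-¬Arc : (D : Digraph n) (w : Fin n) (f : Fin n → Subset k) {u : Fin n} →
                  ¬ Arc D u w → restrictIn D w f u ≡ ∅
restrictIn-¬Arc D w f {u} ¬uw with arc D u w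
... | true = contradiction refl ¬uw
... | false = refl

rdf-empty⇒k≤∑restrictIn : (D : Digraph n) {f : Fin n → Subset k} → IsRDF k D f →
                           ∀ {w} → f w ≡ ∅ → k ≤ ∑[ u < n ] ∣ restrictIn D w f u ∣
rdf-empty⇒k≤∑restrictIn D {f} rdf {w} fw≡∅ = covers⇒k≤∑ (restrictIn D w f) cover
  where
  cover : Covers (restrictIn D w f)
  cover i = let u , uw , i∈fu = rdf w fw≡∅ i in
    u , subst (λ b → i ∈ (if b then f u else ∅)) (sym uw) i∈fu

k≤weight : (D : Digraph n) {f : Fin n → Subset k} → k ≤ n → IsRDF k D f → k ≤ weight f
k≤weight {n} {k} D {f} k≤n rdf = subst (k ≤_) (sym (weight≡∑ f)) k≤∑
  where
  k≤∑ : k ≤ ∑[ v < n ] ∣ f v ∣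
  k≤∑ with any? (λ v → f v ≟∅)
  ... | yes (w , fw≡∅) = ≤-trans (rdf-empty⇒k≤∑restrictIn D rdf fw≡∅) (∑-mono-≤ (∣restrictIn∣≤ D w f))
  ... | no ¬empty = ≤-trans k≤n (n≤∑ λ v → p≢∅⇒1≤∣p∣ (¬empty ∘ (v ,_)))

k<weight : (D : Digraph n) {f : Fin n → Subset k} → IsRDF k D f →
           ∀ {v w} → f w ≡ ∅ → f v ≢ ∅ → ¬ Arc D v w → k < weight f
k<weight {n} {k} D {f} rdf {v} {w} fw≡∅ fv≢∅ ¬vw = begin-strict
  k                                              <⟨ m<m+n k (s≤s z≤n) ⟩
  k + 1                                          ≤⟨ +-mono-≤ (rdf-empty⇒k≤∑restrictIn D rdf fw≡∅) (p≢∅⇒1≤∣p∣ fv≢∅) ⟩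
  ∑[ u < n ] ∣ restrictIn D w f u ∣ + ∣ f v ∣    ≤⟨ ∑-mono-≤-slack (∣restrictIn∣≤ D w f) v restrictedᵥ ⟩
  ∑[ u < n ] ∣ f u ∣                             ≡⟨ weight≡∑ f ⟨
  weight f                                       ∎
  where
  open ≤-Reasoning
  restrictedᵥ : ∣ restrictIn D w f v ∣ + ∣ f v ∣ ≤ ∣ f v ∣
  restrictedᵥ = ≤-reflexive (cong (_+ ∣ f v ∣) (trans (cong ∣_∣ (restrictIn-¬Arc D w f ¬vw)) (∣⊥∣≡0 k)))

support : (Fin n → Subset k) → Subset n
support f = tabulate (λ v → not (does (f v ≟∅)))

∈support⁺ : (f : Fin n → Subset k) {v : Fin n} → f v ≢ ∅ → v ∈ support f
∈support⁺ f {zero} fv≢∅ with f zero ≟∅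
... | yes fv≡∅ = contradiction fv≡∅ fv≢∅
... | no _ = here
∈support⁺ f {suc v} fv≢∅ = there (∈support⁺ (f ∘ suc) fv≢∅)

∉support⁺ : (f : Fin n → Subset k) {v : Fin n} → f v ≡ ∅ → v ∉ support f
∉support⁺ f {zero} fv≡∅ with f zero ≟∅
... | yes _ = λ ()
... | no fv≢∅ = contradiction fv≡∅ fv≢∅
∉support⁺ f {suc v} fv≡∅ (there v∈) = ∉support⁺ (f ∘ suc) fv≡∅ v∈

∉support⁻ : (f : Fin n → Subset k) {v : Fin n} → v ∉ support f → f v ≡ ∅
∉support⁻ f {v} v∉ with f v ≟∅
... | yes fv≡∅ = fv≡∅
... | no fv≢∅ = contradiction (∈support⁺ f fv≢∅) v∉

∣support∣≤weight : (f : Fin n → Subset k) → ∣ support f ∣ ≤ weight f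
∣support∣≤weight f = subst (∣ support f ∣ ≤_) (sym (weight≡∑ f)) (∣support∣≤∑ f)
  where
  ∣support∣≤∑ : ∀ {n} (f : Fin n → Subset k) → ∣ support f ∣ ≤ ∑[ v < n ] ∣ f v ∣
  ∣support∣≤∑ {n = zero} f = z≤n
  ∣support∣≤∑ {n = suc n} f with f zero ≟∅
  ... | yes _ = ≤-trans (∣support∣≤∑ (f ∘ suc)) (m≤n+m _ _)
  ... | no f₀≢∅ = +-mono-≤ (p≢∅⇒1≤∣p∣ f₀≢∅) (∣support∣≤∑ (f ∘ suc))

support-inducedNoIsolated : (D : Digraph n) {f : Fin n → Subset k} → IsTRDF k D f →
                            InducedNoIsolated D (support f)
support-inducedNoIsolated D {f} (_ , totality) v v∈ =
  let u , fu≢∅ , adjacent = totality v (λ fv≡∅ → ∉support⁺ f fv≡∅ v∈) in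
  u , ∈support⁺ f fu≢∅ , adjacent

2≤∣support∣ : (D : Digraph n) {f : Fin n → Subset k} → IsTRDF k D f → 0 < weight f →
              2 ≤ ∣ support f ∣
2≤∣support∣ D {f} (_ , totality) 0<weight =
  let v , 0<∣fv∣ = ∑-positive (∣_∣ ∘ f) (subst (0 <_) (weight≡∑ f) 0<weight)
      fv≢∅ = 1≤∣p∣⇒p≢∅ 0<∣fv∣
      u , fu≢∅ , adjacent = totality v fv≢∅
  in x≢y⇒2≤∣p∣ (∈support⁺ f fu≢∅) (∈support⁺ f fv≢∅) (adjacent⇒≢ D adjacent)

support-dominatesComplement : (D : Digraph n) {f : Fin n → Subset k} → IsRDF k D f →
                              weight f ≤ k → DominatesComplement D (support f)
support-dominatesComplement D {f} rdf weight≤k v v∈ w w∉ with arc? D v w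
... | yes vw = vw
... | no ¬vw = contradiction weight≤k
  (<⇒≱ (k<weight D rdf (∉support⁻ f w∉) (λ fv≡∅ → ∉support⁺ f fv≡∅ v∈) ¬vw))

record ColourSpread (k : ℕ) (X : Subset n) : Set where
  field
    colours  : Fin n → Subset k
    on       : ∀ v → v ∈ X → colours v ≢ ∅
    off      : ∀ v → v ∉ X → colours v ≡ ∅
    covering : Covers colours
    total    : ∑[ v < n ] ∣ colours v ∣ ≡ k

open ColourSpread

spread-skip : {X : Subset n} → ColourSpread k X → ColourSpread k (false ∷ X)
spread-skip s .colours zero = ∅
spread-skip s .colours (suc v) = colours s v
spread-skip s .on (suc v) (there v∈X) = on s v v∈X
spread-skip s .off zero _ = refl
spread-skip s .off (suc v) v∉ = off s v (v∉ ∘ there)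
spread-skip s .covering i = let v , i∈ = covering s i in suc v , i∈
spread-skip {k = k} s .total = trans (cong (_+ sum (∣_∣ ∘ colours s)) (∣⊥∣≡0 k)) (total s)

spread-solo : {X : Subset n} → Empty X → ColourSpread (suc k) (true ∷ X)
spread-solo _ .colours zero = full
spread-solo _ .colours (suc v) = ∅
spread-solo _ .on zero _ = λ ()
spread-solo X-empty .on (suc v) (there v∈X) = ⊥-elim (X-empty (v , v∈X))
spread-solo _ .off zero zero∉ = contradiction here zero∉
spread-solo _ .off (suc v) _ = refl
spread-solo _ .covering i = zero , ∈⊤
spread-solo {n} {k} _ .total = begin
  ∣ full {suc k} ∣ + ∑[ v < n ] ∣ ∅ {suc k} ∣  ≡⟨ cong (∣ full {suc k} ∣ +_) (sum-cong-≗ {n} (λ _ → ∣⊥∣≡0 (suc k))) ⟩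
  ∣ full {suc k} ∣ + ∑[ v < n ] 0              ≡⟨ cong₂ _+_ (∣⊤∣≡n (suc k)) (sum-replicate-zero n) ⟩
  suc k + 0                                    ≡⟨ +-identityʳ (suc k) ⟩
  suc k                                        ∎
  where open ≡-Reasoning

spread-cons : {X : Subset n} → ColourSpread k X → ColourSpread (suc k) (true ∷ X)
spread-cons s .colours zero = ⁅ zero ⁆
spread-cons s .colours (suc v) = false ∷ colours s v
spread-cons s .on zero _ = λ ()
spread-cons s .on (suc v) (there v∈X) = on s v v∈X ∘ ∷-injectiveʳ
spread-cons s .off zero zero∉ = contradiction here zero∉
spread-cons s .off (suc v) v∉ = cong (false ∷_) (off s v (v∉ ∘ there))
spread-cons s .covering zero = zero , here
spread-cons s .covering (suc i) = let v , i∈ = covering s i in suc v , there i∈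
spread-cons {k = k} s .total = cong suc (trans (cong (_+ sum (∣_∣ ∘ colours s)) (∣⊥∣≡0 k)) (total s))

spread : (X : Subset n) → 1 ≤ ∣ X ∣ → ∣ X ∣ ≤ k → ColourSpread k X
spread (false ∷ X) 1≤∣X∣ ∣X∣≤k = spread-skip (spread X 1≤∣X∣ ∣X∣≤k)
spread (true ∷ X) _ (s≤s ∣X∣≤k) with nonempty? X
... | no X-empty = spread-solo X-empty
... | yes (_ , x∈X) = spread-cons (spread X (x∈p⇒1≤∣p∣ x∈X) ∣X∣≤k)

spread⇒TRDF : (D : Digraph n) {X : Subset n} (s : ColourSpread k X) →
              InducedNoIsolated D X → DominatesComplement D X → IsTRDF k D (colours s)
spread⇒TRDF D {X} s inducedX dominatesX = rdf , totality
  where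
  rdf : IsRDF _ D (colours s)
  rdf v cv≡∅ i with v ∈? X | covering s i
  ... | yes v∈X | _ = contradiction cv≡∅ (on s v v∈X)
  ... | no v∉X | u , i∈cu with u ∈? X
  ...   | yes u∈X = u , dominatesX u u∈X v v∉X , i∈cu
  ...   | no u∉X = contradiction (subst (i ∈_) (off s u u∉X) i∈cu) ∉⊥
  totality : ∀ v → colours s v ≢ ∅ → ∃ λ u → colours s u ≢ ∅ × (Arc D u v ⊎ Arc D v u)
  totality v cv≢∅ with v ∈? X
  ... | no v∉X = contradiction (off s v v∉X) cv≢∅
  ... | yes v∈X = let u , u∈X , adjacent = inducedX v v∈X in u , on s u u∈X , adjacent

constant-TRDF : (D : Digraph n) → NoIsolated D → (c : Fin k) → IsTRDF k D (λ _ → ⁅ c ⁆)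
constant-TRDF D noIsolated c =
  (λ _ ⁅c⁆≡∅ → contradiction ⁅c⁆≡∅ ⁅c⁆≢∅) ,
  (λ v _ → let u , adjacent = neighbour D noIsolated v in u , ⁅c⁆≢∅ , adjacent)
  where
  ⁅c⁆≢∅ : ⁅ c ⁆ ≢ ∅
  ⁅c⁆≢∅ = x∈p⇒p≢∅ (x∈⁅x⁆ c)

weight-constant : (c : Fin k) → weight (λ (_ : Fin n) → ⁅ c ⁆) ≡ n
weight-constant {n = n} c = begin
  weight (λ (_ : Fin n) → ⁅ c ⁆)  ≡⟨ weight≡∑ {n} (λ _ → ⁅ c ⁆) ⟩
  ∑[ v < n ] ∣ ⁅ c ⁆ ∣             ≡⟨ sum-cong-≗ {n} (λ _ → ∣⁅x⁆∣≡1 c) ⟩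
  ∑[ v < n ] 1                     ≡⟨ ∑1≡n n ⟩
  n                                ∎
  where open ≡-Reasoning

inducedNoIsolated-full : (D : Digraph n) → NoIsolated D → InducedNoIsolated D full
inducedNoIsolated-full D noIsolated v _ = let u , adjacent = neighbour D noIsolated v in u , ∈⊤ , adjacent

dominatingSet⇒γ≡k : (D : Digraph n) {X : Subset n} → k ≤ n → 1 ≤ ∣ X ∣ → ∣ X ∣ ≤ k →
                    InducedNoIsolated D X → DominatesComplement D X → TRDNumber k D k
dominatingSet⇒γ≡k D {X} k≤n 1≤∣X∣ ∣X∣≤k inducedX dominatesX =
  (colours s , spread⇒TRDF D s inducedX dominatesX , trans (weight≡∑ (colours s)) (total s)) ,
  λ _ trdf → k≤weight D k≤n (proj₁ trdf)
  where
  s : ColourSpread _ X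
  s = spread X 1≤∣X∣ ∣X∣≤k

γ≤n : {m : ℕ} (D : Digraph n) → NoIsolated D → 1 ≤ k → TRDNumber k D m → m ≤ n
γ≤n {k = k} D noIsolated 1≤k (_ , minimal) =
  subst (_ ≤_) (weight-constant c) (minimal _ (constant-TRDF D noIsolated c))
  where
  c : Fin k
  c = fromℕ< 1≤k

γ≡k-Condition : ℕ → Digraph n → Set
γ≡k-Condition {n} k D =
  n ≡ k ⊎ (k + 1 ≤ n × ∃ λ (X : Subset n) → 2 ≤ ∣ X ∣ × ∣ X ∣ ≤ k ×
                                              InducedNoIsolated D X × DominatesComplement D X)

γ≡k⇒condition : (D : Digraph n) → NoIsolated D → 1 ≤ k → TRDNumber k D k → γ≡k-Condition k D
γ≡k⇒condition {n} {k} D noIsolated 1≤k γ≡k@((f , trdf , weight≡k) , _) with n ≤? k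
... | yes n≤k = inj₁ (≤-antisym n≤k (γ≤n D noIsolated 1≤k γ≡k))
... | no n≰k = inj₂ (subst (_≤ n) (+-comm 1 k) (≰⇒> n≰k) ,
  support f ,
  2≤∣support∣ D trdf (subst (0 <_) (sym weight≡k) 1≤k) ,
  subst (∣ support f ∣ ≤_) weight≡k (∣support∣≤weight f) ,
  support-inducedNoIsolated D trdf ,
  support-dominatesComplement D (proj₁ trdf) (≤-reflexive weight≡k))

condition⇒γ≡k : (D : Digraph n) → NoIsolated D → 1 ≤ k → γ≡k-Condition k D → TRDNumber k D k
condition⇒γ≡k D noIsolated 1≤k (inj₁ refl) =
  dominatingSet⇒γ≡k D ≤-refl (subst (1 ≤_) (sym (∣⊤∣≡n _)) 1≤k) (≤-reflexive (∣⊤∣≡n _))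
    (inducedNoIsolated-full D noIsolated) (λ _ _ _ w∉ → contradiction ∈⊤ w∉)
condition⇒γ≡k D _ _ (inj₂ (k+1≤n , X , 2≤∣X∣ , ∣X∣≤k , inducedX , dominatesX)) =
  dominatingSet⇒γ≡k D (≤-trans (m≤m+n _ 1) k+1≤n) (≤-trans (n≤1+n 1) 2≤∣X∣) ∣X∣≤k inducedX dominatesX

theorem3p1 : (k n : ℕ) → 2 ≤ k → (D : Digraph n) → NoIsolated D →
    TRDNumber k D k ⇔
      (n ≡ k ⊎
       (k + 1 ≤ n × (∃ λ (X : Subset n) → 2 ≤ ∣ X ∣ × ∣ X ∣ ≤ k ×
          InducedNoIsolated D X ×
          (∀ v → v ∈ X → ∀ w → w ∉ X → Arc D v w))))
theorem3p1 k n 2≤k D noIsolated =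
  mk⇔ (γ≡k⇒condition D noIsolated 1≤k) (condition⇒γ≡k D noIsolated 1≤k)
  where
  1≤k : 1 ≤ k
  1≤k = ≤-trans (n≤1+n 1) 2≤k
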